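{- Let $G$ be a connected chordal graph and let $\mathcal{T}$ be a clique tree for $G$. Let $\mathcal{K}$ be a set of (maximal) cliques of $G$ and let $C$ be a (maximal) clique with $C\notin\mathcal{K}$. Let $\mathcal{K}'$ be the multiset $\{K\setminus C : K\in\mathcal{K}\}$. If the intersection graph of $\mathcal{K}'$ is connected, then $C$ does not lie on the path in $\mathcal{T}$ between any two members of $\mathcal{K}$.
   Context: A graph is chordal if it has no induced cycle on four or more vertices. Here a clique means a maximal complete subgraph (identified with its vertex set). A clique tree of a chordal graph $G$ is a tree whose nodes are the maximal cliques of $G$, such that for each vertex $v$ of $G$ the cliques containing $v$ induce a connected subtree. The intersection graph of a (multi)set of sets has one vertex per member, two members being adjacent iff they intersect. -}

module Defs where

open import Data.Nat using (ℕ; suc; _+_)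
open import Data.Nat.DivMod using (_%_; m%n<n)
open import Data.Fin using (Fin; toℕ; fromℕ<)
open import Data.Fin.Subset using (Subset; _∈_; _∉_; _⊆_)
open import Data.List using (List; []; _∷_)
open import Data.List.Membership.Propositional renaming (_∈_ to _∈ₗ_)
open import Data.List.Relation.Unary.Unique.Propositional using (Unique)
open import Data.Product using (Σ; ∃; _×_)
open import Function using (Injective)
open import Relation.Nullary using (¬_)
open import Relation.Binary using (Decidable)
open import Relation.Binary.PropositionalEquality using (_≡_; _≢_)
open import Relation.Binary.Construct.Closure.ReflexiveTransitive using (Star)
open import Data.Sum using (_⊎_)

record Graph (n : ℕ) : Set₁ where
  field
    Adj    : Fin n → Fin n → Set
    adj?   : Decidable Adj
    sym    : ∀ {u v} → Adj u v → Adj v u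
    irrefl : ∀ {u} → ¬ Adj u u
open Graph public

Connected : ∀ {n} → Graph n → Set
Connected G = ∀ u v → Star (Adj G) u v

next : ∀ {k} → Fin (suc k) → Fin (suc k)
next {k} i = fromℕ< (m%n<n (suc (toℕ i)) (suc k))

IsCycle : ∀ {n k} → Graph n → (Fin (suc k) → Fin n) → Set
IsCycle G c = Injective _≡_ _≡_ c × (∀ i → Adj G (c i) (c (next i)))

IsInducedCycle : ∀ {n k} → Graph n → (Fin (suc k) → Fin n) → Set
IsInducedCycle G c =
  IsCycle G c × (∀ i j → Adj G (c i) (c j) → (j ≡ next i) ⊎ (i ≡ next j))

Chordal : ∀ {n} → Graph n → Set
Chordal G = ∀ k (c : Fin (4 + k) → _) → ¬ IsInducedCycle G c

IsTree : ∀ {m} → Graph m → Set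
IsTree T = Connected T × (∀ k (c : Fin (3 + k) → _) → ¬ IsCycle T c)

IsComplete : ∀ {n} → Graph n → Subset n → Set
IsComplete G S = ∀ u v → u ∈ S → v ∈ S → u ≢ v → Adj G u v

IsMaxClique : ∀ {n} → Graph n → Subset n → Set
IsMaxClique G S = IsComplete G S × (∀ S′ → IsComplete G S′ → S ⊆ S′ → S′ ⊆ S)

record CliqueTree {n} (G : Graph n) : Set₁ where
  field
    m        : ℕ
    K        : Fin m → Subset n
    K-inj    : Injective _≡_ _≡_ K
    K-max    : ∀ i → IsMaxClique G (K i)
    K-onto   : ∀ S → IsMaxClique G S → ∃ λ i → K i ≡ S
    T        : Graph m
    T-tree   : IsTree T
    subtree  : ∀ v i j → v ∈ K i → v ∈ K j →
               Star (λ x y → Adj T x y × v ∈ K x × v ∈ K y) i j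

data Walk {m} (E : Fin m → Fin m → Set) : Fin m → Fin m → List (Fin m) → Set where
  here : ∀ {a} → Walk E a a (a ∷ [])
  step : ∀ {a b c xs} → E a b → Walk E b c xs → Walk E a c (a ∷ xs)

LiesOnPath : ∀ {m} → Graph m → Fin m → Fin m → Fin m → Set
LiesOnPath T a b c = Σ (List _) λ xs → Walk (Adj T) a b xs × Unique xs × c ∈ₗ xs

-- Every vertex v ∉ C spans a subtree of 𝒯 avoiding the node C, so each overlap of two
-- members of 𝒦 outside C yields a walk in 𝒯 − C; connectivity of the intersection graph of
-- 𝒦′ thus puts all of 𝒦 in one component of 𝒯 − C. But in a tree, removing a node C on the
-- path between a and b separates a from b: a walk around C between its two path neighbours
-- would close a cycle through C.
module Submission where

open import Defs hiding (sym)
open import Data.Nat using (ℕ; zero; suc; _<_; _<?_; s≤s; _+_)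
open import Data.Nat.Properties using (≤-antisym; ≮⇒≥; suc-injective)
open import Data.Nat.DivMod using (_%_; m<n⇒m%n≡m; n%n≡0; m%n<n)
open import Data.Fin using (Fin; toℕ) renaming (_≟_ to _≟ᶠ_)
open import Data.Fin.Properties using (toℕ-fromℕ<; toℕ<n; toℕ-injective)
open import Data.Fin.Subset using (Subset; _∈_; _∉_)
open import Data.List using (List; []; _∷_; length)
open import Data.List.Relation.Unary.All using (All; []; _∷_) renaming (lookup to All-lookup)
open import Data.List.Relation.Unary.All.Properties using (¬Any⇒All¬)
open import Data.List.Relation.Unary.Any using (here; there)
open import Data.List.Relation.Unary.AllPairs using ([]; _∷_)
open import Data.List.Relation.Unary.Unique.Propositional using (Unique)
open import Data.List.Membership.Propositional using () renaming (_∈_ to _∈ₗ_)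
open import Data.Product using (∃; Σ; _×_; _,_; proj₂)
open import Data.Empty using (⊥-elim)
open import Relation.Nullary using (¬_; yes; no)
open import Relation.Binary.PropositionalEquality
  using (_≡_; _≢_; refl; sym; trans; cong; subst; subst₂)
open import Relation.Binary.Construct.Closure.ReflexiveTransitive
  using (Star; ε; _◅_; _◅◅_; map; reverse; kleisliStar)

index : ∀ {a} {A : Set a} → A → List A → ℕ → A
index d []       _       = d
index d (x ∷ xs) zero    = x
index d (x ∷ xs) (suc n) = index d xs n

module _ {a} {A : Set a} where

  index-∈ : ∀ (d : A) xs n → n < length xs → index d xs n ∈ₗ xs
  index-∈ d (x ∷ xs) zero    _       = here refl
  index-∈ d (x ∷ xs) (suc n) (s≤s p) = there (index-∈ d xs n p)

  index-injective : ∀ (d : A) xs → Unique xs → ∀ i j → i < length xs → j < length xs →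
                    index d xs i ≡ index d xs j → i ≡ j
  index-injective d (x ∷ xs) _        zero    zero    _       _       _ = refl
  index-injective d (x ∷ xs) (x∉ ∷ _) zero    (suc j) _       (s≤s q) e =
    ⊥-elim (All-lookup x∉ (index-∈ d xs j q) e)
  index-injective d (x ∷ xs) (x∉ ∷ _) (suc i) zero    (s≤s p) _       e =
    ⊥-elim (All-lookup x∉ (index-∈ d xs i p) (sym e))
  index-injective d (x ∷ xs) (_ ∷ u)  (suc i) (suc j) (s≤s p) (s≤s q) e =
    cong suc (index-injective d xs u i j p q e)

module _ {m : ℕ} {E : Fin m → Fin m → Set} where
  open import Data.List.Membership.DecPropositional (_≟ᶠ_ {m}) using (_∈?_)

  walk-head∈ : ∀ {a b xs} → Walk E a b xs → a ∈ₗ xs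
  walk-head∈ here       = here refl
  walk-head∈ (step _ _) = here refl

  index-walk-head : ∀ {a b xs} d → Walk E a b xs → index d xs 0 ≡ a
  index-walk-head d here       = refl
  index-walk-head d (step _ _) = refl

  index-walk-step : ∀ {a b xs} d n → Walk E a b xs → suc n < length xs →
                    E (index d xs n) (index d xs (suc n))
  index-walk-step d zero    (step e w) _       = subst (E _) (sym (index-walk-head d w)) e
  index-walk-step d (suc n) (step e w) (s≤s p) = index-walk-step d n w p
  index-walk-step d _       here       (s≤s ())

  index-walk-last : ∀ {a b xs} d n → Walk E a b xs → suc n ≡ length xs → index d xs n ≡ b
  index-walk-last d zero    here                _ = refl
  index-walk-last d zero    (step _ here)       ()
  index-walk-last d zero    (step _ (step _ _)) ()
  index-walk-last d (suc n) (step _ w)          p = index-walk-last d n w (suc-injective p)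

  walk-length≥2 : ∀ {a b xs} → Walk E a b xs → a ≢ b → ∃ λ k → length xs ≡ 2 + k
  walk-length≥2 here                          a≢b = ⊥-elim (a≢b refl)
  walk-length≥2 (step _ here)                 _   = 0 , refl
  walk-length≥2 (step _ (step {xs = xs} _ _)) _   = length xs , refl

  UniqueWalk : Fin m → Fin m → Set
  UniqueWalk a b = Σ (List (Fin m)) λ xs → Walk E a b xs × Unique xs

  suffix-from : ∀ {u a b xs} → Walk E a b xs → Unique xs → u ∈ₗ xs → UniqueWalk u b
  suffix-from here       u       (here refl) = _ , here , u
  suffix-from (step e w) u       (here refl) = _ , step e w , u
  suffix-from (step _ w) (_ ∷ u) (there p)   = suffix-from w u p

  loop-erase : ∀ {a b} → Star E a b → UniqueWalk a b
  loop-erase {a} ε = a ∷ [] , here , [] ∷ []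
  loop-erase {a} (e ◅ s) with loop-erase s
  ... | xs , w , u with a ∈? xs
  ...   | yes a∈ = suffix-from w u a∈
  ...   | no  a∉ = a ∷ xs , step e w , ¬Any⇒All¬ xs a∉ ∷ u

toℕ-next : ∀ {k} (i : Fin (suc k)) → toℕ (next i) ≡ suc (toℕ i) % suc k
toℕ-next {k} i = toℕ-fromℕ< (m%n<n (suc (toℕ i)) (suc k))

module _ {m : ℕ} (T : Graph m) where

  closed-walk⇒cycle : ∀ {x y xs} k → length xs ≡ suc k → Walk (Adj T) x y xs → Unique xs →
                      Adj T y x → IsCycle T (λ (i : Fin (suc k)) → index x xs (toℕ i))
  closed-walk⇒cycle {x} {y} {xs} k len w u y—x = injective , adjacent
    where
    in-range : ∀ (i : Fin (suc k)) → toℕ i < length xs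
    in-range i = subst (toℕ i <_) (sym len) (toℕ<n i)

    injective : ∀ {i j} → index x xs (toℕ i) ≡ index x xs (toℕ j) → i ≡ j
    injective {i} {j} e = toℕ-injective (index-injective x xs u _ _ (in-range i) (in-range j) e)

    adjacent : ∀ i → Adj T (index x xs (toℕ i)) (index x xs (toℕ (next i)))
    adjacent i with suc (toℕ i) <? suc k
    ... | yes i+1<n = subst (λ n → Adj T (index x xs (toℕ i)) (index x xs n))
                        (sym (trans (toℕ-next i) (m<n⇒m%n≡m i+1<n)))
                        (index-walk-step x (toℕ i) w (subst (suc (toℕ i) <_) (sym len) i+1<n))
    ... | no  i+1≮n = subst₂ (Adj T) (sym (index-walk-last x (toℕ i) w (trans i+1≡n (sym len))))
                        (sym (trans (cong (index x xs) next-i≡0) (index-walk-head x w)))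
                        y—x
      where
      i+1≡n : suc (toℕ i) ≡ suc k
      i+1≡n = ≤-antisym (toℕ<n i) (≮⇒≥ i+1≮n)
      next-i≡0 : toℕ (next i) ≡ 0
      next-i≡0 = trans (toℕ-next i) (trans (cong (_% suc k) i+1≡n) (n%n≡0 (suc k)))

  Acyclic : Set
  Acyclic = ∀ k (c : Fin (3 + k) → Fin m) → ¬ IsCycle T c

  AdjWithout : Fin m → Fin m → Fin m → Set
  AdjWithout C x y = Adj T x y × x ≢ C × y ≢ C

  AdjWithout-sym : ∀ {C x y} → AdjWithout C x y → AdjWithout C y x
  AdjWithout-sym (e , x≢C , y≢C) = Graph.sym T e , y≢C , x≢C

  walk-avoiding⇒star : ∀ {C a b xs} → Walk (Adj T) a b xs → All (C ≢_) xs → Star (AdjWithout C) a b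
  walk-avoiding⇒star here       _          = ε
  walk-avoiding⇒star (step e w) (C≢a ∷ C∉) =
    (e , (λ eq → C≢a (sym eq)) , (λ eq → All-lookup C∉ (walk-head∈ w) (sym eq)))
    ◅ walk-avoiding⇒star w C∉

  walkWithout⇒walk : ∀ {C a b xs} → Walk (AdjWithout C) a b xs → Walk (Adj T) a b xs
  walkWithout⇒walk here             = here
  walkWithout⇒walk (step (e , _) w) = step e (walkWithout⇒walk w)

  walkWithout-avoids : ∀ {C a b xs} → Walk (AdjWithout C) a b xs → b ≢ C → All (C ≢_) xs
  walkWithout-avoids here                   b≢C = (λ eq → b≢C (sym eq)) ∷ []
  walkWithout-avoids (step (_ , a≢C , _) w) b≢C = (λ eq → a≢C (sym eq)) ∷ walkWithout-avoids w b≢C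

  module _ (acyclic : Acyclic) where

    neighbours-separated : ∀ {C x y} → x ≢ y → Adj T C x → Adj T C y → ¬ Star (AdjWithout C) x y
    neighbours-separated {C} {x} {y} x≢y C—x C—y s with loop-erase s
    ... | xs , walk , xs-unique with walk-length≥2 walk x≢y
    ... | k , len = acyclic k _ (closed-walk⇒cycle (2 + k) (cong suc len)
                      (step C—x (walkWithout⇒walk walk))
                      (walkWithout-avoids walk y≢C ∷ xs-unique) (Graph.sym T C—y))
      where
      y≢C : y ≢ C
      y≢C refl = Graph.irrefl T C—y

    path-separates′ : ∀ {C a b xs} → Walk (Adj T) a b xs → Unique xs → C ∈ₗ xs →
                      C ≢ a → C ≢ b → ¬ Star (AdjWithout C) a b
    path-separates′ here       _ (here C≡a) C≢a _ _ = C≢a C≡a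
    path-separates′ (step _ _) _ (here C≡a) C≢a _ _ = C≢a C≡a
    path-separates′ {C} (step {b = a′} e w) (_ ∷ u) (there C∈) C≢a C≢b s with a′ ≟ᶠ C
    ... | no a′≢C = path-separates′ w u C∈ (λ eq → a′≢C (sym eq)) C≢b
                      ((Graph.sym T e , a′≢C , (λ eq → C≢a (sym eq))) ◅ s)
    path-separates′ (step e here)            _ _ _ C≢b _ | yes refl = C≢b refl
    path-separates′ (step e (step C—w walk)) (a∉ ∷ C∉ ∷ _) _ _ _ s | yes refl =
      neighbours-separated (All-lookup a∉ (there (walk-head∈ walk))) (Graph.sym T e) C—w
        (s ◅◅ reverse AdjWithout-sym (walk-avoiding⇒star walk C∉))

    path-separates : ∀ {C a b} → LiesOnPath T a b C → C ≢ a → C ≢ b → ¬ Star (AdjWithout C) a b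
    path-separates (_ , w , u , C∈) = path-separates′ w u C∈

module _ {n} {G : Graph n} (𝒯 : CliqueTree G) where
  open CliqueTree 𝒯

  subtree-avoiding : ∀ {v C i j} → v ∉ K C → v ∈ K i → v ∈ K j → Star (AdjWithout T C) i j
  subtree-avoiding {v} {C} {i} {j} v∉C v∈i v∈j = map avoid (subtree v i j v∈i v∈j)
    where
    avoid : ∀ {x y} → Adj T x y × v ∈ K x × v ∈ K y → AdjWithout T C x y
    avoid (e , v∈x , v∈y) = e , (λ { refl → v∉C v∈x }) , (λ { refl → v∉C v∈y })

lemma23 : ∀ {n} (G : Graph n) → Connected G → Chordal G →
          (𝒯 : CliqueTree G) →
          let open CliqueTree 𝒯 in
          (𝒦 : Subset m) (C : Fin m) → C ∉ 𝒦 →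
          (∀ i j → i ∈ 𝒦 → j ∈ 𝒦 →
             Star (λ x y → x ∈ 𝒦 × y ∈ 𝒦 × x ≢ y ×
                           ∃ λ v → v ∈ K x × v ∈ K y × v ∉ K C) i j) →
          ∀ a b → a ∈ 𝒦 → b ∈ 𝒦 → ¬ LiesOnPath T a b C
lemma23 G _ _ 𝒯 𝒦 C C∉𝒦 overlap-connected a b a∈𝒦 b∈𝒦 C-on-path =
  path-separates T (proj₂ T-tree) C-on-path (≢C a∈𝒦) (≢C b∈𝒦)
    (kleisliStar (λ x → x) overlap⇒walk (overlap-connected a b a∈𝒦 b∈𝒦))
  where
  open CliqueTree 𝒯
  ≢C : ∀ {x} → x ∈ 𝒦 → C ≢ x
  ≢C x∈𝒦 refl = C∉𝒦 x∈𝒦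
  overlap⇒walk : ∀ {x y} → x ∈ 𝒦 × y ∈ 𝒦 × x ≢ y × (∃ λ v → v ∈ K x × v ∈ K y × v ∉ K C) →
                 Star (AdjWithout T C) x y
  overlap⇒walk (_ , _ , _ , v , v∈x , v∈y , v∉C) = subtree-avoiding 𝒯 v∉C v∈x v∈y
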